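{- Let $\mathcal{A}$ be a real affine hyperplane arrangement with Tits algebra $\Bbbk\Sigma[\mathcal{A}]$ over a field $\Bbbk$, and let $s,t\in\Bbbk$. If $u\in\Bbbk\Sigma[\mathcal{A}]$ is a characteristic element of parameter $s$ and $v\in\Bbbk\Sigma[\mathcal{A}]$ is a characteristic element of parameter $t$, then the product $uv$ (in the Tits algebra) is a characteristic element of parameter $st$.
   Context: A real affine hyperplane arrangement $\mathcal{A}$ is a finite set of affine hyperplanes in a finite-dimensional real vector space $V$. The hyperplanes split $V$ into a finite collection $\Sigma[\mathcal{A}]$ of convex polyhedra called faces (the closures of the nonempty sets obtained by specifying, for each hyperplane, on which open side of it or on it the points lie). For faces $F,G$, the Tits product $FG$ is the unique face containing $F$ and a small segment starting at a point of the relative interior of $F$ in the direction of a point of the relative interior of $G$; this makes $\Sigma[\mathcal{A}]$ a semigroup. A flat is a nonempty intersection of hyperplanes of $\mathcal{A}$ (the empty intersection being $V$); flats are ordered by inclusion. All minimal flats have a common dimension $d$; the rank of a face $F$ is $\dim F-d$ and the rank of a flat $X$ is $\dim X-d$. The support $\mathrm{supp}(F)$ of a face is the smallest flat containing it. The Tits algebra $\Bbbk\Sigma[\mathcal{A}]$ is the semigroup algebra with basis $\{\mathtt{H}_F\}_{F\in\Sigma[\mathcal{A}]}$ and product $\mathtt{H}_F\mathtt{H}_G=\mathtt{H}_{FG}$. For $w=\sum_F w^F\mathtt{H}_F$ and a flat $X$, set $\chi_X(w)=\sum_{F:\,\mathrm{supp}(F)\subseteq X} w^F$. An element $w$ is characteristic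 of parameter $t\in\Bbbk$ if $\chi_X(w)=t^{\mathrm{rank}(X)}$ for every flat $X$. -}

module Defs where

open import Level using (Level; _⊔_)
open import Algebra.Bundles using (CommutativeRing)
open import Relation.Binary.Structures using (IsStrictTotalOrder)
open import Data.Nat using (ℕ; zero; suc; _∸_)
open import Data.Fin using (Fin; zero; suc)
open import Data.Fin.Subset using (Subset; _∈_)
open import Data.Vec using ([]; _∷_)
open import Data.Bool using (Bool; true; false; not; _∧_; _∨_)
open import Data.Product using (Σ; ∃; _×_; _,_; proj₁; proj₂)
open import Data.List using (List; []; _∷_; map; concatMap)
open import Data.List.Relation.Unary.All using (All)
open import Relation.Nullary using (¬_)
open import Relation.Binary.PropositionalEquality using (_≡_)
open import Function.Bundles using (_⇔_)

record Field (c ℓ : Level) : Set (Level.suc (c ⊔ ℓ)) where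
  field
    commutativeRing : CommutativeRing c ℓ
  open CommutativeRing commutativeRing public
  field
    1≉0     : ¬ (1# ≈ 0#)
    inverse : ∀ x → ¬ (x ≈ 0#) → ∃ λ y → (x * y) ≈ 1#

-- The real numbers, axiomatised as a complete ordered field
-- (these axioms determine ℝ up to isomorphism).

record RealField (c ℓ : Level) : Set (Level.suc (c ⊔ ℓ)) where
  field
    field′ : Field c ℓ
  open Field field′ public
  field
    _<_                : Carrier → Carrier → Set ℓ
    isStrictTotalOrder : IsStrictTotalOrder _≈_ _<_
    +-mono-<           : ∀ {x y} z → x < y → (x + z) < (y + z)
    *-pos              : ∀ {x y} → 0# < x → 0# < y → 0# < (x * y)
    -- least-upper-bound property for nonempty subsets bounded above
    -- (x ≤ y is written ¬ (y < x))
    complete : (P : Carrier → Set (c ⊔ ℓ)) → (∃ λ x → P x) →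
               (∃ λ b → ∀ x → P x → ¬ (b < x)) →
               ∃ λ s → (∀ x → P x → ¬ (s < x)) ×
                       (∀ b → (∀ x → P x → ¬ (b < x)) → ¬ (b < s))

module RingOps {c ℓ : Level} (K : CommutativeRing c ℓ) where
  open CommutativeRing K using (Carrier; 0#; 1#; _+_; _*_)

  ∑ : ∀ {k} → (Fin k → Carrier) → Carrier
  ∑ {zero}  f = 0#
  ∑ {suc k} f = f zero + ∑ (λ i → f (suc i))

  pow : Carrier → ℕ → Carrier
  pow x zero    = 1#
  pow x (suc r) = x * pow x r

data Sign : Set where
  neg zer pos : Sign

isZer : Sign → Bool
isZer zer = true
isZer _   = false

SignVec : ℕ → Set
SignVec m = Fin m → Sign

-- composition of sign vectors (the Tits product of faces)
_∘ˢ_ : ∀ {m} → SignVec m → SignVec m → SignVec m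
(σ ∘ˢ τ) i with σ i
... | zer = τ i
... | s   = s

zeroOn : ∀ {m} → Subset m → SignVec m → Bool
zeroOn {zero}  []      σ = true
zeroOn {suc m} (b ∷ S) σ = (not b ∨ isZer (σ zero)) ∧ zeroOn S (λ i → σ (suc i))

module Geometry {c ℓ : Level} (R : RealField c ℓ) where
  open RealField R using (Carrier; _≈_; _<_; 0#; _*_; _-_; commutativeRing)
  open RingOps commutativeRing

  Point : ℕ → Set c
  Point n = Fin n → Carrier

  affine : ∀ {n} → Point n → Carrier → Point n → Carrier
  affine a b x = ∑ (λ k → a k * x k) - b

  record Arrangement (n m : ℕ) : Set (c ⊔ ℓ) where
    field
      a : Fin m → Point n
      b : Fin m → Carrier          -- offsets; H_i = {x | a_i · x = b_i}
      nonzero  : ∀ i → ¬ (∀ k → a i k ≈ 0#)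
      distinct : ∀ i j → (∀ x → (affine (a i) (b i) x ≈ 0#) ⇔ (affine (a j) (b j) x ≈ 0#)) → i ≡ j
    f : Fin m → Point n → Carrier
    f i = affine (a i) (b i)

  HasSign : Sign → Carrier → Set (c ⊔ ℓ)
  HasSign neg r = Level.Lift (c ⊔ ℓ) (r < 0#)
  HasSign zer r = Level.Lift (c ⊔ ℓ) (r ≈ 0#)
  HasSign pos r = Level.Lift (c ⊔ ℓ) (0# < r)

  module _ {n m : ℕ} (A : Arrangement n m) where
    open Arrangement A

    IsFace : SignVec m → Set (c ⊔ ℓ)
    IsFace σ = ∃ λ (x : Point n) → ∀ i → HasSign (σ i) (f i x)

    -- flats: nonempty intersections of the hyperplanes indexed by S
    InFlat : Subset m → Point n → Set ℓ
    InFlat S x = ∀ i → i ∈ S → f i x ≈ 0#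

    IsFlat : Subset m → Set (c ⊔ ℓ)
    IsFlat S = ∃ λ x → InFlat S x

    IsMinimalFlat : Subset m → Set (c ⊔ ℓ)
    IsMinimalFlat S = IsFlat S ×
      (∀ T → IsFlat T → (∀ x → InFlat T x → InFlat S x) → ∀ x → InFlat S x → InFlat T x)

    InDir : Subset m → Point n → Set (c ⊔ ℓ)
    InDir S v = ∃ λ x → ∃ λ y → InFlat S x × InFlat S y × (∀ k → v k ≈ (x k - y k))

    LinIndep : ∀ {k} → (Fin k → Point n) → Set (c ⊔ ℓ)
    LinIndep {k} vs = ∀ (γ : Fin k → Carrier) →
      (∀ j → ∑ (λ i → γ i * vs i j) ≈ 0#) → ∀ i → γ i ≈ 0#

    HasDim : Subset m → ℕ → Set (c ⊔ ℓ)
    HasDim S e =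
      (∃ λ (vs : Fin e → Point n) → (∀ i → InDir S (vs i)) × LinIndep vs) ×
      (∀ (vs : Fin (suc e) → Point n) → (∀ i → InDir S (vs i)) → ¬ LinIndep vs)

    module Tits {c′ ℓ′ : Level} (K : Field c′ ℓ′) where
      open Field K using () renaming (Carrier to 𝕜; _≈_ to _≈ₖ_; _*_ to _*ₖ_; _+_ to _+ₖ_; 0# to 0ₖ)
      open RingOps (Field.commutativeRing K) using () renaming (∑ to ∑ₖ; pow to powₖ)

      -- an element ∑ w^F H_F, given as a finite formal linear combination
      TitsElt : Set c′
      TitsElt = List (SignVec m × 𝕜)

      IsTitsElt : TitsElt → Set (c ⊔ ℓ ⊔ c′)
      IsTitsElt w = All (λ p → IsFace (proj₁ p)) w

      _·ᵀ_ : TitsElt → TitsElt → TitsElt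
      u ·ᵀ v = concatMap (λ p → map (λ q → (proj₁ p ∘ˢ proj₁ q , proj₂ p *ₖ proj₂ q)) v) u

      -- χ_X(w) = ∑_{supp F ⊆ X} w^F   (supp F ⊆ X iff F lies on every H_i, i ∈ S)
      χ : Subset m → TitsElt → 𝕜
      χ S [] = 0ₖ
      χ S ((σ , w) ∷ ws) with zeroOn S σ
      ... | true  = w +ₖ χ S ws
      ... | false = χ S ws

      -- characteristic of parameter t: χ_X(w) = t^{rank X}, rank X = dim X - dim(minimal flat)
      IsCharacteristic : 𝕜 → TitsElt → Set (c ⊔ ℓ ⊔ ℓ′)
      IsCharacteristic t w = ∀ X → IsFlat X → ∀ Y → IsMinimalFlat Y →
        ∀ d e → HasDim Y d → HasDim X e → χ X w ≈ₖ powₖ t (e ∸ d)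

-- A face FG lies in a flat X iff both F and G do: a coordinate of the sign
-- vector σ ∘ˢ τ vanishes iff it vanishes in σ and in τ. Hence each χ_X is
-- multiplicative on the Tits algebra, and χ_X(uv) = s^r t^r = (st)^r.
{-# OPTIONS --safe #-}
module Submission where

open import Defs
open import Level using (Level)
open import Data.Nat using (ℕ; zero; suc; _∸_)
open import Data.Fin using (zero; suc)
open import Data.Fin.Subset using (Subset)
open import Data.Vec using ([]; _∷_)
open import Data.Bool using (Bool; true; false; not; _∧_; _∨_)
open import Data.Bool.Properties using (∨-distribˡ-∧; ∧-commutativeMonoid)
open import Data.Product using (_×_; _,_)
open import Data.List using ([]; _∷_; map; _++_)
open import Function using (_∘_)
open import Relation.Binary.PropositionalEquality
  using (_≡_; refl; cong; cong₂; module ≡-Reasoning)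
open import Algebra.Bundles using (CommutativeMonoid)
import Algebra.Properties.CommutativeSemigroup as CommutativeSemigroupProperties
import Algebra.Properties.CommutativeSemiring.Exp as CommutativeSemiringExp
import Relation.Binary.Reasoning.Setoid as SetoidReasoning

isZer-∘ˢ : ∀ {m} (σ τ : SignVec m) i → isZer ((σ ∘ˢ τ) i) ≡ isZer (σ i) ∧ isZer (τ i)
isZer-∘ˢ σ τ i with σ i
... | neg = refl
... | zer = refl
... | pos = refl

zeroOn-∧ : ∀ {m} (S : Subset m) (ρ σ τ : SignVec m) →
           (∀ i → isZer (ρ i) ≡ isZer (σ i) ∧ isZer (τ i)) →
           zeroOn S ρ ≡ zeroOn S σ ∧ zeroOn S τ
zeroOn-∧ {zero}  []      ρ σ τ ρ≡σ∧τ = refl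
zeroOn-∧ {suc m} (b ∷ S) ρ σ τ ρ≡σ∧τ = begin
  (not b ∨ isZer (ρ zero)) ∧ zeroOn S (ρ ∘ suc)
    ≡⟨ cong₂ (λ x y → (not b ∨ x) ∧ y) (ρ≡σ∧τ zero)
             (zeroOn-∧ S (ρ ∘ suc) (σ ∘ suc) (τ ∘ suc) (ρ≡σ∧τ ∘ suc)) ⟩
  (not b ∨ (x ∧ y)) ∧ (p ∧ q)
    ≡⟨ cong (_∧ (p ∧ q)) (∨-distribˡ-∧ (not b) x y) ⟩
  ((not b ∨ x) ∧ (not b ∨ y)) ∧ (p ∧ q)
    ≡⟨ interchange (not b ∨ x) (not b ∨ y) p q ⟩
  ((not b ∨ x) ∧ p) ∧ ((not b ∨ y) ∧ q) ∎
  where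
  open ≡-Reasoning
  open CommutativeSemigroupProperties
    (CommutativeMonoid.commutativeSemigroup ∧-commutativeMonoid) using (interchange)
  x y p q : Bool
  x = isZer (σ zero)
  y = isZer (τ zero)
  p = zeroOn S (σ ∘ suc)
  q = zeroOn S (τ ∘ suc)

zeroOn-∘ˢ : ∀ {m} (S : Subset m) (σ τ : SignVec m) →
            zeroOn S (σ ∘ˢ τ) ≡ zeroOn S σ ∧ zeroOn S τ
zeroOn-∘ˢ S σ τ = zeroOn-∧ S (σ ∘ˢ τ) σ τ (isZer-∘ˢ σ τ)

module _ {c′ ℓ′ : Level} (K : Field c′ ℓ′) where
  open Field K using (_≈_; _*_; commutativeRing; commutativeSemiring)
  open RingOps commutativeRing using (pow)
  open CommutativeSemiringExp commutativeSemiring using (_^_; ^-distrib-*)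

  pow≡^ : ∀ x k → pow x k ≡ x ^ k
  pow≡^ x zero    = refl
  pow≡^ x (suc k) = cong (x *_) (pow≡^ x k)

  pow-distrib-* : ∀ x y k → pow (x * y) k ≈ pow x k * pow y k
  pow-distrib-* x y k rewrite pow≡^ (x * y) k | pow≡^ x k | pow≡^ y k = ^-distrib-* x y k

module _ {c ℓ c′ ℓ′ : Level} (R : RealField c ℓ) (K : Field c′ ℓ′) {n m : ℕ}
         (A : Geometry.Arrangement R n m) where
  open Geometry.Tits R A K
  open Field K renaming (refl to ≈-refl)
  open SetoidReasoning setoid

  χ-++ : ∀ S us vs → χ S (us ++ vs) ≈ χ S us + χ S vs
  χ-++ S []             vs = sym (+-identityˡ _)
  χ-++ S ((σ , w) ∷ us) vs with zeroOn S σ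
  ... | true  = trans (+-congˡ (χ-++ S us vs)) (sym (+-assoc _ _ _))
  ... | false = χ-++ S us vs

  leftMul : SignVec m → Carrier → SignVec m × Carrier → SignVec m × Carrier
  leftMul σ w (τ , x) = (σ ∘ˢ τ , w * x)

  χ-leftMul-zeroOn : ∀ S σ w vs → zeroOn S σ ≡ true →
                     χ S (map (leftMul σ w) vs) ≈ w * χ S vs
  χ-leftMul-zeroOn S σ w []             σ-zeroOn = sym (zeroʳ w)
  χ-leftMul-zeroOn S σ w ((τ , x) ∷ vs) σ-zeroOn rewrite zeroOn-∘ˢ S σ τ | σ-zeroOn with zeroOn S τ
  ... | true  = trans (+-congˡ (χ-leftMul-zeroOn S σ w vs σ-zeroOn)) (sym (distribˡ w x (χ S vs)))
  ... | false = χ-leftMul-zeroOn S σ w vs σ-zeroOn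

  χ-leftMul-¬zeroOn : ∀ S σ w vs → zeroOn S σ ≡ false →
                      χ S (map (leftMul σ w) vs) ≈ 0#
  χ-leftMul-¬zeroOn S σ w []             σ-¬zeroOn = ≈-refl
  χ-leftMul-¬zeroOn S σ w ((τ , x) ∷ vs) σ-¬zeroOn rewrite zeroOn-∘ˢ S σ τ | σ-¬zeroOn =
    χ-leftMul-¬zeroOn S σ w vs σ-¬zeroOn

  χ-·ᵀ : ∀ S us vs → χ S (us ·ᵀ vs) ≈ χ S us * χ S vs
  χ-·ᵀ S []             vs = sym (zeroˡ _)
  χ-·ᵀ S ((σ , w) ∷ us) vs with zeroOn S σ in zeroOnσ
  ... | true  = begin
    χ S (map (leftMul σ w) vs ++ (us ·ᵀ vs))    ≈⟨ χ-++ S (map (leftMul σ w) vs) (us ·ᵀ vs) ⟩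
    χ S (map (leftMul σ w) vs) + χ S (us ·ᵀ vs) ≈⟨ +-cong (χ-leftMul-zeroOn S σ w vs zeroOnσ) (χ-·ᵀ S us vs) ⟩
    w * χ S vs + χ S us * χ S vs               ≈⟨ distribʳ _ _ _ ⟨
    (w + χ S us) * χ S vs                      ∎
  ... | false = begin
    χ S (map (leftMul σ w) vs ++ (us ·ᵀ vs))    ≈⟨ χ-++ S (map (leftMul σ w) vs) (us ·ᵀ vs) ⟩
    χ S (map (leftMul σ w) vs) + χ S (us ·ᵀ vs) ≈⟨ +-cong (χ-leftMul-¬zeroOn S σ w vs zeroOnσ) (χ-·ᵀ S us vs) ⟩
    0# + χ S us * χ S vs                       ≈⟨ +-identityˡ _ ⟩
    χ S us * χ S vs                            ∎

  isCharacteristic-·ᵀ : ∀ s t us vs → IsCharacteristic s us → IsCharacteristic t vs →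
                        IsCharacteristic (s * t) (us ·ᵀ vs)
  isCharacteristic-·ᵀ s t us vs χus χvs X flat Y minimal d e dimY dimX = begin
    χ X (us ·ᵀ vs)                   ≈⟨ χ-·ᵀ X us vs ⟩
    χ X us * χ X vs                  ≈⟨ *-cong (χus X flat Y minimal d e dimY dimX)
                                               (χvs X flat Y minimal d e dimY dimX) ⟩
    pow s (e ∸ d) * pow t (e ∸ d)    ≈⟨ pow-distrib-* K s t (e ∸ d) ⟨
    pow (s * t) (e ∸ d)              ∎
    where open RingOps commutativeRing using (pow)

lemma2p1 : ∀ {c ℓ c′ ℓ′ : Level} (R : RealField c ℓ) (K : Field c′ ℓ′) {n m : ℕ}
           (A : Geometry.Arrangement R n m) (s t : Field.Carrier K)
           (u v : Geometry.Tits.TitsElt R A K) →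
           Geometry.Tits.IsTitsElt R A K u → Geometry.Tits.IsTitsElt R A K v →
           Geometry.Tits.IsCharacteristic R A K s u →
           Geometry.Tits.IsCharacteristic R A K t v →
           Geometry.Tits.IsCharacteristic R A K (Field._*_ K s t) (Geometry.Tits._·ᵀ_ R A K u v)
lemma2p1 R K A s t u v _ _ = isCharacteristic-·ᵀ R K A s t u v
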